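{- Let $M\le N$ be integers and let $(u_n)_{n=M}^N$ be a sequence of algebraic numbers which is both a proper polynomial-exponential sequence of rank $r$ and a proper polynomial-exponential sequence of rank $\tilde r$. Then $r=\tilde r$. Moreover, the number $s$ and the pairs $(\alpha_i,P_i)$, $1\le i\le s$, in a representation $u_n=\sum_{i=1}^sP_i(n)\alpha_i^n$ ($M\le n\le N$) witnessing properness are unique up to rearrangement.
   Context: For integers $M\le N$ and $r\in\mathbb{N}_0$, a sequence $(u_n)_{n=M}^N$ of algebraic numbers is a polynomial-exponential sequence of rank $r$ if there exist $s\in\mathbb{N}_0$, distinct nonzero algebraic numbers $\alpha_1,\ldots,\alpha_s$, and nonzero polynomials $P_1,\ldots,P_s\in\overline{\mathbb{Q}}[z]$ such that $u_n=P_1(n)\alpha_1^n+\cdots+P_s(n)\alpha_s^n$ for $M\le n\le N$ and $s+\sum_{i=1}^s\deg P_i=r$ (for $r=0$ this means all $u_n=0$). It is a proper polynomial-exponential sequence of rank $r$ if moreover $r\le (N-M+1)/2$. -}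

module Defs where

open import Level using (Level; _⊔_)
open import Data.Nat as ℕ using (ℕ; zero; suc)
open import Data.Fin using (Fin; zero; suc; fromℕ; toℕ; fromℕ<)
open import Data.Integer as ℤ using (ℤ; +_; -[1+_])
open import Data.Product using (Σ; _×_; _,_; ∃; ∃-syntax)
open import Relation.Nullary using (¬_; Dec; yes; no)
open import Relation.Binary.PropositionalEquality using (_≡_; _≢_)
open import Function.Bundles using (Bijection; _⤖_)
open import Algebra.Bundles using (CommutativeRing)

module RingOps {c ℓ : Level} (R : CommutativeRing c ℓ) where
  open CommutativeRing R using (Carrier; _≈_; _+_; _*_; -_; 0#; 1#)

  ΣF : (n : ℕ) → (Fin n → Carrier) → Carrier
  ΣF zero    f = 0#
  ΣF (suc n) f = f zero + ΣF n (λ i → f (suc i))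

  _^ℕ_ : Carrier → ℕ → Carrier
  x ^ℕ zero  = 1#
  x ^ℕ suc k = x * (x ^ℕ k)

  ιℕ : ℕ → Carrier
  ιℕ zero    = 0#
  ιℕ (suc n) = 1# + ιℕ n

  ιℤ : ℤ → Carrier
  ιℤ (+ n)      = ιℕ n
  ιℤ -[1+ n ]   = - ιℕ (suc n)

  evalPoly : (d : ℕ) → (Fin (suc d) → Carrier) → Carrier → Carrier
  evalPoly d c z = ΣF (suc d) (λ j → c j * (z ^ℕ toℕ j))

-- A model of the field of algebraic numbers  Q̄ : a field (with decidable
-- equality and an inverse function) of characteristic 0, algebraically
-- closed, and algebraic over ℚ (every element is a root of a nonzero
-- polynomial with integer coefficients).  Such a field is an algebraic
-- closure of ℚ, i.e. (isomorphic to) Q̄.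
record AlgebraicNumbers (c ℓ : Level) : Set (Level.suc (c ⊔ ℓ)) where
  field
    ring : CommutativeRing c ℓ
  open CommutativeRing ring using (Carrier; _≈_; _+_; _*_; -_; 0#; 1#)
  open RingOps ring
  field
    _≟_     : (x y : Carrier) → Dec (x ≈ y)
    _⁻¹     : Carrier → Carrier
    0≉1     : ¬ (0# ≈ 1#)
    inverse : ∀ x → ¬ (x ≈ 0#) → (x * (x ⁻¹)) ≈ 1#
    char0      : ∀ n → ¬ (ιℕ (suc n) ≈ 0#)
    algClosed  : ∀ (d : ℕ) (c : Fin (suc (suc d)) → Carrier) →
                 ¬ (c (fromℕ (suc d)) ≈ 0#) →
                 ∃[ z ] (evalPoly (suc d) c z ≈ 0#)
    algebraic  : ∀ x → ∃[ d ] Σ (Fin (suc d) → ℤ) λ c →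
                 ¬ (c (fromℕ d) ≡ + 0) × (evalPoly d (λ j → ιℤ (c j)) x ≈ 0#)

module PolyExp {c ℓ : Level} (K : AlgebraicNumbers c ℓ) where
  open AlgebraicNumbers K public
  open CommutativeRing ring public using (Carrier; _≈_; _+_; _*_; -_; 0#; 1#)
  open RingOps ring public

  _^ℤ_ : Carrier → ℤ → Carrier
  x ^ℤ (+ k)      = x ^ℕ k
  x ^ℤ -[1+ k ]   = (x ⁻¹) ^ℕ suc k

  record NZPoly : Set (c ⊔ ℓ) where
    constructor mkPoly
    field
      deg   : ℕ
      coef  : Fin (suc deg) → Carrier
      lead≉0 : ¬ (coef (fromℕ deg) ≈ 0#)

    eval : Carrier → Carrier
    eval = evalPoly deg coef

    coeff : ℕ → Carrier
    coeff j with j ℕ.<? suc deg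
    ... | yes j<  = coef (fromℕ< j<)
    ... | no  _   = 0#

  open NZPoly public

  record PERep : Set (c ⊔ ℓ) where
    field
      s        : ℕ
      α        : Fin s → Carrier
      P        : Fin s → NZPoly
      α≉0      : ∀ i → ¬ (α i ≈ 0#)
      distinct : ∀ i j → i ≢ j → ¬ (α i ≈ α j)

    rank : ℕ
    rank = s ℕ.+ sumℕ s (λ i → deg (P i))
      where
      sumℕ : (n : ℕ) → (Fin n → ℕ) → ℕ
      sumℕ zero    f = 0
      sumℕ (suc n) f = f zero ℕ.+ sumℕ n (λ i → f (suc i))

    value : ℤ → Carrier
    value n = ΣF s (λ i → eval (P i) (ιℤ n) * (α i ^ℤ n))

  open PERep public

  Represents : (M N : ℤ) → (ℤ → Carrier) → PERep → Set ℓ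
  Represents M N u R = ∀ n → M ℤ.≤ n → n ℤ.≤ N → u n ≈ value R n

  -- properness:  r ≤ (N - M + 1)/2,  i.e.  2r ≤ N - M + 1
  ProperRank : (M N : ℤ) → ℕ → Set
  ProperRank M N r = + (2 ℕ.* r) ℤ.≤ (N ℤ.- M) ℤ.+ + 1

  IsPE : (M N : ℤ) → (ℤ → Carrier) → ℕ → Set (c ⊔ ℓ)
  IsPE M N u r = Σ PERep λ R → Represents M N u R × rank R ≡ r

  IsProperPE : (M N : ℤ) → (ℤ → Carrier) → ℕ → Set (c ⊔ ℓ)
  IsProperPE M N u r = IsPE M N u r × ProperRank M N r

  SameUpToRearrangement : PERep → PERep → Set ℓ
  SameUpToRearrangement R R' =
    s R ≡ s R' ×
    Σ (Fin (s R) ⤖ Fin (s R')) λ σ →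
      ∀ i → let j = Bijection.to σ i in
        (α R i ≈ α R' j) × (deg (P R i) ≡ deg (P R' j)) ×
        (∀ k → coeff (P R i) k ≈ coeff (P R' j) k)

module Submission where

-- Subtracting two proper representations of (uₙ) gives a sum of terms P(n) βⁿ of rank at most
-- r + r̃ ≤ N − M + 1 which vanishes at every point of the window. Such a sum is trivial: once terms
-- with equal bases are merged, each coefficient polynomial is zero. By induction, apply E − β
-- (E the shift n ↦ n + 1) for the base β of one term: this lowers the degree of the β-part,
-- keeps the other degrees and costs one point of the window. If all merged polynomials of the
-- result vanish, each merged polynomial C of the original, with base γ, satisfies
-- γ C(x + 1) = β C(x). For γ ≠ β this forces C = 0; for γ = β it makes C periodic, and C
-- vanishes at M because there the sum reduces to C(M) βᴹ. Comparing the merged polynomials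
-- base by base then matches the two representations term by term, so their bases, polynomials
-- and ranks agree.

open import Defs
open import Level using (Level)
open import Algebra.Bundles using (CommutativeRing)
import Algebra.Solver.Ring.NaturalCoefficients.Default as SemiringSolver
import Algebra.Properties.CommutativeMonoid.Sum as MonoidSum
import Algebra.Properties.CommutativeSemigroup as CommutativeSemigroupProperties
open import Data.Empty using (⊥-elim)
open import Data.Fin as Fin using (Fin; fromℕ; fromℕ<)
import Data.Fin.Properties as FinP
open import Data.Fin.Permutation using (↔⇒≡)
import Data.Integer as ℤ
open ℤ using (ℤ; +_)
import Data.Integer.Properties as ℤP
open import Data.Integer.Tactic.RingSolver using (solve-∀)
open import Data.List as List using (List; []; _∷_; _++_; length; tabulate)
import Data.List.Properties as ListP
open import Data.List.Relation.Unary.All using (All; []; _∷_)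
open import Data.List.Relation.Unary.All.Properties using (++⁺; tabulate⁺; map⁺)
import Data.Nat as ℕ
open ℕ using (ℕ; zero; suc; z≤n; s≤s)
import Data.Nat.Properties as ℕP
import Data.Nat.ListAction as ℕL
open import Data.Nat.ListAction.Properties using (sum-++)
open import Data.Product using (Σ; _×_; _,_; proj₁; proj₂)
open import Function.Base using (_∘_)
open import Function.Bundles using (_↔_; mk↔ₛ′)
open import Function.Properties.Inverse using (↔⇒⤖)
open import Function.Properties.Bijection using (⤖⇒↔)
open import Relation.Nullary using (¬_; Dec; yes; no)
open import Relation.Binary.Definitions using (tri<; tri≈; tri>)
open import Relation.Binary.PropositionalEquality as ≡ using (_≡_; _≢_)

1+[M+j]≡M+[1+j] : ∀ (M j : ℤ) → + 1 ℤ.+ (M ℤ.+ j) ≡ M ℤ.+ (+ 1 ℤ.+ j)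
1+[M+j]≡M+[1+j] = solve-∀

M+[N-M]≡N : ∀ (M N : ℤ) → M ℤ.+ (N ℤ.- M) ≡ N
M+[N-M]≡N = solve-∀

width : ℤ → ℤ → ℕ
width M N = suc ℤ.∣ N ℤ.- M ∣

+∣N-M∣≡N-M : ∀ {M N} → M ℤ.≤ N → + ℤ.∣ N ℤ.- M ∣ ≡ N ℤ.- M
+∣N-M∣≡N-M M≤N = ℤP.0≤i⇒+∣i∣≡i (ℤP.i≤j⇒0≤j-i M≤N)

in-window : ∀ {M N} → M ℤ.≤ N → ∀ k → k ℕ.< width M N → M ℤ.≤ M ℤ.+ + k × M ℤ.+ + k ℤ.≤ N
in-window {M} {N} M≤N k (s≤s k≤∣N-M∣) =
  ℤP.i≤i+j M (+ k) ,
  ℤP.≤-trans (ℤP.+-monoʳ-≤ M (ℤ.+≤+ k≤∣N-M∣))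
             (ℤP.≤-reflexive (≡.trans (≡.cong (λ d → M ℤ.+ d) (+∣N-M∣≡N-M M≤N)) (M+[N-M]≡N M N)))

double≤width : ∀ {M N} r → M ℤ.≤ N → + (2 ℕ.* r) ℤ.≤ (N ℤ.- M) ℤ.+ + 1 → 2 ℕ.* r ℕ.≤ width M N
double≤width {M} {N} r M≤N 2r≤N-M+1 =
  ≡.subst (2 ℕ.* r ℕ.≤_) (ℕP.+-comm ℤ.∣ N ℤ.- M ∣ 1)
    (ℤP.drop‿+≤+ (≡.subst (λ z → + (2 ℕ.* r) ℤ.≤ z ℤ.+ + 1) (≡.sym (+∣N-M∣≡N-M M≤N)) 2r≤N-M+1))

halves⇒sum≤ : ∀ {a b L} → 2 ℕ.* a ℕ.≤ L → 2 ℕ.* b ℕ.≤ L → a ℕ.+ b ℕ.≤ L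
halves⇒sum≤ {a} {b} {L} 2a≤L 2b≤L = ℕP.*-cancelˡ-≤ 2 (begin
  2 ℕ.* (a ℕ.+ b)         ≡⟨ ℕP.*-distribˡ-+ 2 a b ⟩
  2 ℕ.* a ℕ.+ 2 ℕ.* b     ≤⟨ ℕP.+-mono-≤ 2a≤L 2b≤L ⟩
  L ℕ.+ L                 ≡⟨ ≡.cong (L ℕ.+_) (ℕP.+-identityʳ L) ⟨
  2 ℕ.* L                 ∎)
  where open ℕP.≤-Reasoning

module PolynomialExponential {c ℓ : Level} (K : AlgebraicNumbers c ℓ) where
  open PolyExp K
  open CommutativeRing ring
    using (setoid; refl; sym; trans; reflexive; +-cong; +-congˡ; +-congʳ; *-cong; *-congˡ; *-congʳ;
           +-assoc; +-comm; *-comm; *-assoc; +-identityˡ; +-identityʳ; *-identityˡ; *-identityʳ;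
           distribˡ; -‿cong; -‿inverseˡ; zeroˡ; zeroʳ; +-group; +-abelianGroup;
           commutativeSemiring; *-commutativeSemigroup; +-commutativeSemigroup)
    renaming (ring to ringʳ)
  open import Relation.Binary.Reasoning.Setoid setoid
  open import Algebra.Properties.Group +-group using (ε⁻¹≈ε; ∙-cancelˡ; x∙y⁻¹≈ε⇒x≈y; x≈y⇒x∙y⁻¹≈ε; ⁻¹-anti-homo-∙)
  open import Algebra.Properties.AbelianGroup +-abelianGroup using (xyx⁻¹≈y; ⁻¹-∙-comm)
  open import Algebra.Properties.Ring ringʳ using (-‿distribˡ-*; -‿distribʳ-*)
  open CommutativeSemigroupProperties +-commutativeSemigroup using () renaming (x∙yz≈y∙xz to +-left-comm)
  open CommutativeSemigroupProperties *-commutativeSemigroup using () renaming (x∙yz≈y∙xz to *-left-comm)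
  open SemiringSolver commutativeSemiring using (solve; _:=_; _:+_; _:*_; con)

  *-cancelˡ : ∀ {a u v} → ¬ a ≈ 0# → a * u ≈ a * v → u ≈ v
  *-cancelˡ {a} {u} {v} a≉0 au≈av = begin
    u                ≈⟨ *-identityˡ u ⟨
    1# * u           ≈⟨ *-congʳ a⁻¹a≈1 ⟨
    (a ⁻¹ * a) * u   ≈⟨ *-assoc (a ⁻¹) a u ⟩
    a ⁻¹ * (a * u)   ≈⟨ *-congˡ au≈av ⟩
    a ⁻¹ * (a * v)   ≈⟨ *-assoc (a ⁻¹) a v ⟨
    (a ⁻¹ * a) * v   ≈⟨ *-congʳ a⁻¹a≈1 ⟩
    1# * v           ≈⟨ *-identityˡ v ⟩
    v                ∎
    where
    a⁻¹a≈1 : a ⁻¹ * a ≈ 1#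
    a⁻¹a≈1 = trans (*-comm (a ⁻¹) a) (inverse a a≉0)

  *-cancelʳ : ∀ {a b u} → ¬ u ≈ 0# → a * u ≈ b * u → a ≈ b
  *-cancelʳ {a} {b} {u} u≉0 au≈bu = *-cancelˡ u≉0 (trans (*-comm u a) (trans au≈bu (*-comm b u)))

  a*b≈0⇒b≈0 : ∀ {a b} → ¬ a ≈ 0# → a * b ≈ 0# → b ≈ 0#
  a*b≈0⇒b≈0 {a} a≉0 ab≈0 = *-cancelˡ a≉0 (trans ab≈0 (sym (zeroʳ a)))

  *-nonzero : ∀ {a b} → ¬ a ≈ 0# → ¬ b ≈ 0# → ¬ a * b ≈ 0#
  *-nonzero a≉0 b≉0 ab≈0 = b≉0 (a*b≈0⇒b≈0 a≉0 ab≈0)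

  ⁻¹-nonzero : ∀ {a} → ¬ a ≈ 0# → ¬ a ⁻¹ ≈ 0#
  ⁻¹-nonzero {a} a≉0 a⁻¹≈0 = 0≉1 (begin
    0#         ≈⟨ zeroʳ a ⟨
    a * 0#     ≈⟨ *-congˡ a⁻¹≈0 ⟨
    a * a ⁻¹   ≈⟨ inverse a a≉0 ⟩
    1#         ∎)

  ⁻¹-cong : ∀ {a b} → ¬ a ≈ 0# → a ≈ b → a ⁻¹ ≈ b ⁻¹
  ⁻¹-cong {a} {b} a≉0 a≈b = *-cancelˡ a≉0 (trans (inverse a a≉0) (sym (begin
    a * b ⁻¹   ≈⟨ *-congʳ a≈b ⟩
    b * b ⁻¹   ≈⟨ inverse b (λ b≈0 → a≉0 (trans a≈b b≈0)) ⟩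
    1#         ∎)))

  ^ℕ-cong : ∀ {a b} k → a ≈ b → a ^ℕ k ≈ b ^ℕ k
  ^ℕ-cong zero    a≈b = refl
  ^ℕ-cong (suc k) a≈b = *-cong a≈b (^ℕ-cong k a≈b)

  ^ℕ-nonzero : ∀ {a} k → ¬ a ≈ 0# → ¬ a ^ℕ k ≈ 0#
  ^ℕ-nonzero zero    a≉0 1≈0 = 0≉1 (sym 1≈0)
  ^ℕ-nonzero (suc k) a≉0     = *-nonzero a≉0 (^ℕ-nonzero k a≉0)

  ^ℤ-nonzero : ∀ {a} n → ¬ a ≈ 0# → ¬ a ^ℤ n ≈ 0#
  ^ℤ-nonzero (+ k)      a≉0 = ^ℕ-nonzero k a≉0
  ^ℤ-nonzero ℤ.-[1+ k ] a≉0 = ^ℕ-nonzero (suc k) (⁻¹-nonzero a≉0)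

  ^ℤ-cong : ∀ {a b} n → ¬ a ≈ 0# → a ≈ b → a ^ℤ n ≈ b ^ℤ n
  ^ℤ-cong (+ k)      a≉0 a≈b = ^ℕ-cong k a≈b
  ^ℤ-cong ℤ.-[1+ k ] a≉0 a≈b = ^ℕ-cong (suc k) (⁻¹-cong a≉0 a≈b)

  *-inverse-cancelˡ : ∀ {a} y → ¬ a ≈ 0# → a * (a ⁻¹ * y) ≈ y
  *-inverse-cancelˡ {a} y a≉0 = begin
    a * (a ⁻¹ * y)   ≈⟨ *-assoc a (a ⁻¹) y ⟨
    (a * a ⁻¹) * y   ≈⟨ *-congʳ (inverse a a≉0) ⟩
    1# * y           ≈⟨ *-identityˡ y ⟩
    y                ∎

  ^ℤ-suc : ∀ {a} n → ¬ a ≈ 0# → a ^ℤ ℤ.suc n ≈ a * a ^ℤ n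
  ^ℤ-suc (+ k)          a≉0 = refl
  ^ℤ-suc ℤ.-[1+ zero ]  a≉0 = sym (*-inverse-cancelˡ 1# a≉0)
  ^ℤ-suc ℤ.-[1+ suc k ] a≉0 = sym (*-inverse-cancelˡ _ a≉0)

  -[1+w]+1≈-w : ∀ w → - (1# + w) + 1# ≈ - w
  -[1+w]+1≈-w w = begin
    - (1# + w) + 1#     ≈⟨ +-congʳ (⁻¹-anti-homo-∙ 1# w) ⟩
    (- w + - 1#) + 1#   ≈⟨ +-assoc (- w) (- 1#) 1# ⟩
    - w + (- 1# + 1#)   ≈⟨ +-congˡ (-‿inverseˡ 1#) ⟩
    - w + 0#            ≈⟨ +-identityʳ (- w) ⟩
    - w                 ∎

  ιℤ-suc : ∀ n → ιℤ (ℤ.suc n) ≈ ιℤ n + 1#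
  ιℤ-suc (+ k)            = +-comm 1# (ιℕ k)
  ιℤ-suc ℤ.-[1+ zero ]    = sym (trans (-[1+w]+1≈-w 0#) ε⁻¹≈ε)
  ιℤ-suc ℤ.-[1+ suc k ]   = sym (-[1+w]+1≈-w (ιℕ (suc k)))

  -- Polynomials as coefficient lists

  Poly : Set c
  Poly = List Carrier

  ⟦_⟧ : Poly → Carrier → Carrier
  ⟦ []    ⟧ x = 0#
  ⟦ a ∷ p ⟧ x = a + x * ⟦ p ⟧ x

  ⟦⟧-cong : ∀ p {x y} → x ≈ y → ⟦ p ⟧ x ≈ ⟦ p ⟧ y
  ⟦⟧-cong []      x≈y = refl
  ⟦⟧-cong (a ∷ p) x≈y = +-congˡ (*-cong x≈y (⟦⟧-cong p x≈y))

  infixl 6 _⊕_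
  _⊕_ : Poly → Poly → Poly
  []      ⊕ q       = q
  (a ∷ p) ⊕ []      = a ∷ p
  (a ∷ p) ⊕ (b ∷ q) = a + b ∷ p ⊕ q

  scale : Carrier → Poly → Poly
  scale a = List.map (a *_)

  negate : Poly → Poly
  negate = List.map -_

  shift : Poly → Poly
  shift []      = []
  shift (a ∷ p) = (a ∷ shift p) ⊕ shift p

  Δ : Poly → Poly
  Δ []          = []
  Δ (a ∷ [])    = []
  Δ (a ∷ b ∷ p) = shift (b ∷ p) ⊕ (0# ∷ Δ (b ∷ p))

  divide : Carrier → Poly → Poly
  divide a []           = []
  divide a (b ∷ [])     = []
  divide a (b ∷ b′ ∷ p) = ⟦ b′ ∷ p ⟧ a ∷ divide a (b′ ∷ p)

  coefficient : Poly → ℕ → Carrier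
  coefficient []      k       = 0#
  coefficient (a ∷ p) zero    = a
  coefficient (a ∷ p) (suc k) = coefficient p k

  ⟦⊕⟧ : ∀ p q x → ⟦ p ⊕ q ⟧ x ≈ ⟦ p ⟧ x + ⟦ q ⟧ x
  ⟦⊕⟧ []      q       x = sym (+-identityˡ _)
  ⟦⊕⟧ (a ∷ p) []      x = sym (+-identityʳ _)
  ⟦⊕⟧ (a ∷ p) (b ∷ q) x = begin
    (a + b) + x * ⟦ p ⊕ q ⟧ x             ≈⟨ +-congˡ (*-congˡ (⟦⊕⟧ p q x)) ⟩
    (a + b) + x * (⟦ p ⟧ x + ⟦ q ⟧ x)     ≈⟨ solve 5 (λ a b x u v → (a :+ b) :+ x :* (u :+ v)
                                                   := (a :+ x :* u) :+ (b :+ x :* v)) refl a b x _ _ ⟩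
    (a + x * ⟦ p ⟧ x) + (b + x * ⟦ q ⟧ x) ∎

  ⟦scale⟧ : ∀ a p x → ⟦ scale a p ⟧ x ≈ a * ⟦ p ⟧ x
  ⟦scale⟧ a []      x = sym (zeroʳ a)
  ⟦scale⟧ a (b ∷ p) x = begin
    a * b + x * ⟦ scale a p ⟧ x   ≈⟨ +-congˡ (*-congˡ (⟦scale⟧ a p x)) ⟩
    a * b + x * (a * ⟦ p ⟧ x)     ≈⟨ +-congˡ (*-left-comm x a _) ⟩
    a * b + a * (x * ⟦ p ⟧ x)     ≈⟨ distribˡ a b _ ⟨
    a * (b + x * ⟦ p ⟧ x)         ∎

  ⟦negate⟧ : ∀ p x → ⟦ negate p ⟧ x ≈ - ⟦ p ⟧ x
  ⟦negate⟧ []      x = sym ε⁻¹≈ε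
  ⟦negate⟧ (b ∷ p) x = begin
    - b + x * ⟦ negate p ⟧ x   ≈⟨ +-congˡ (*-congˡ (⟦negate⟧ p x)) ⟩
    - b + x * - ⟦ p ⟧ x        ≈⟨ +-congˡ (-‿distribʳ-* x _) ⟨
    - b + - (x * ⟦ p ⟧ x)      ≈⟨ ⁻¹-∙-comm b _ ⟩
    - (b + x * ⟦ p ⟧ x)        ∎

  ⟦shift⟧ : ∀ p x → ⟦ shift p ⟧ x ≈ ⟦ p ⟧ (x + 1#)
  ⟦shift⟧ []      x = refl
  ⟦shift⟧ (a ∷ p) x = begin
    ⟦ (a ∷ shift p) ⊕ shift p ⟧ x              ≈⟨ ⟦⊕⟧ (a ∷ shift p) (shift p) x ⟩
    (a + x * ⟦ shift p ⟧ x) + ⟦ shift p ⟧ x    ≈⟨ +-cong (+-congˡ (*-congˡ (⟦shift⟧ p x))) (⟦shift⟧ p x) ⟩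
    (a + x * y) + y                            ≈⟨ solve 3 (λ a x y → (a :+ x :* y) :+ y
                                                          := a :+ (x :+ con 1) :* y) refl a x y ⟩
    a + (x + 1#) * y                           ∎
    where y = ⟦ p ⟧ (x + 1#)

  ⟦Δ⟧ : ∀ p x → ⟦ p ⟧ (x + 1#) ≈ ⟦ p ⟧ x + ⟦ Δ p ⟧ x
  ⟦Δ⟧ []          x = sym (+-identityʳ 0#)
  ⟦Δ⟧ (a ∷ [])    x = solve 2 (λ a x → a :+ (x :+ con 1) :* con 0 := (a :+ x :* con 0) :+ con 0) refl a x
  ⟦Δ⟧ (a ∷ r@(b ∷ p)) x = begin
    a + (x + 1#) * ⟦ r ⟧ (x + 1#)              ≈⟨ +-congˡ (*-congˡ (⟦Δ⟧ r x)) ⟩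
    a + (x + 1#) * (z + d)                     ≈⟨ solve 4 (λ a x z d → a :+ (x :+ con 1) :* (z :+ d)
                                                    := (a :+ x :* z) :+ ((z :+ d) :+ (con 0 :+ x :* d))) refl a x z d ⟩
    (a + x * z) + ((z + d) + (0# + x * d))     ≈⟨ +-congˡ (+-congʳ (⟦Δ⟧ r x)) ⟨
    (a + x * z) + (⟦ r ⟧ (x + 1#) + (0# + x * d)) ≈⟨ +-congˡ (+-congʳ (⟦shift⟧ r x)) ⟨
    (a + x * z) + (⟦ shift r ⟧ x + (0# + x * d)) ≈⟨ +-congˡ (⟦⊕⟧ (shift r) (0# ∷ Δ r) x) ⟨
    (a + x * z) + ⟦ Δ (a ∷ r) ⟧ x              ∎
    where
    z = ⟦ r ⟧ x
    d = ⟦ Δ r ⟧ x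

  factor-theorem : ∀ a d p → ⟦ p ⟧ (a + d) ≈ ⟦ p ⟧ a + d * ⟦ divide a p ⟧ (a + d)
  factor-theorem a d []           = sym (trans (+-identityˡ _) (zeroʳ d))
  factor-theorem a d (b ∷ [])     =
    solve 3 (λ a b d → b :+ (a :+ d) :* con 0 := (b :+ a :* con 0) :+ d :* con 0) refl a b d
  factor-theorem a d (b ∷ r@(b′ ∷ p)) = begin
    b + (a + d) * ⟦ r ⟧ (a + d)                    ≈⟨ +-congˡ (*-congˡ (factor-theorem a d r)) ⟩
    b + (a + d) * (⟦ r ⟧ a + d * q)                ≈⟨ solve 5 (λ a b d r q → b :+ (a :+ d) :* (r :+ d :* q)
                                                        := (b :+ a :* r) :+ d :* (r :+ (a :+ d) :* q)) refl a b d _ q ⟩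
    (b + a * ⟦ r ⟧ a) + d * (⟦ r ⟧ a + (a + d) * q) ∎
    where
    q = ⟦ divide a r ⟧ (a + d)

  coefficient-⊕ : ∀ p q k → coefficient (p ⊕ q) k ≈ coefficient p k + coefficient q k
  coefficient-⊕ []      q       k       = sym (+-identityˡ _)
  coefficient-⊕ (a ∷ p) []      zero    = sym (+-identityʳ a)
  coefficient-⊕ (a ∷ p) []      (suc k) = sym (+-identityʳ _)
  coefficient-⊕ (a ∷ p) (b ∷ q) zero    = refl
  coefficient-⊕ (a ∷ p) (b ∷ q) (suc k) = coefficient-⊕ p q k

  coefficient-negate : ∀ p k → coefficient (negate p) k ≈ - coefficient p k
  coefficient-negate []      k       = sym ε⁻¹≈ε
  coefficient-negate (a ∷ p) zero    = refl
  coefficient-negate (a ∷ p) (suc k) = coefficient-negate p k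

  length-⊕ : ∀ p q {n} → length p ℕ.≤ n → length q ℕ.≤ n → length (p ⊕ q) ℕ.≤ n
  length-⊕ []      q       _         q≤n       = q≤n
  length-⊕ (a ∷ p) []      p≤n       _         = p≤n
  length-⊕ (a ∷ p) (b ∷ q) (s≤s p≤n) (s≤s q≤n) = s≤s (length-⊕ p q p≤n q≤n)

  length-scale : ∀ a p → length (scale a p) ≡ length p
  length-scale a = ListP.length-map (a *_)

  length-shift : ∀ p → length (shift p) ℕ.≤ length p
  length-shift []      = z≤n
  length-shift (a ∷ p) =
    length-⊕ (a ∷ shift p) (shift p) (s≤s (length-shift p)) (ℕP.m≤n⇒m≤1+n (length-shift p))

  length-Δ : ∀ p → length (Δ p) ℕ.≤ ℕ.pred (length p)
  length-Δ []          = z≤n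
  length-Δ (a ∷ [])    = z≤n
  length-Δ (a ∷ b ∷ p) =
    length-⊕ (shift (b ∷ p)) (0# ∷ Δ (b ∷ p)) (length-shift (b ∷ p)) (s≤s (length-Δ (b ∷ p)))

  length-divide : ∀ a p → length (divide a p) ℕ.≤ ℕ.pred (length p)
  length-divide a []           = z≤n
  length-divide a (b ∷ [])     = z≤n
  length-divide a (b ∷ b′ ∷ p) = s≤s (length-divide a (b′ ∷ p))

  +-sub-cancel : ∀ a x → a + (x + - a) ≈ x
  +-sub-cancel a x = trans (sym (+-assoc a x (- a))) (xyx⁻¹≈y a x)

  vanishes-on-progression : ∀ p a → (∀ k → ⟦ p ⟧ (a + ιℕ k) ≈ 0#) → ∀ x → ⟦ p ⟧ x ≈ 0#
  vanishes-on-progression p = go (length p) p ℕP.≤-refl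
    where
    go : ∀ n p → length p ℕ.≤ n → ∀ a → (∀ k → ⟦ p ⟧ (a + ιℕ k) ≈ 0#) → ∀ x → ⟦ p ⟧ x ≈ 0#
    go n       []         _         a p[a+k]≈0 x = refl
    go (suc n) p@(_ ∷ _)  p≤1+n     a p[a+k]≈0 x = begin
      ⟦ p ⟧ x                                       ≈⟨ ⟦⟧-cong p (+-sub-cancel a x) ⟨
      ⟦ p ⟧ (a + (x + - a))                         ≈⟨ factor-theorem a (x + - a) p ⟩
      ⟦ p ⟧ a + (x + - a) * ⟦ D ⟧ (a + (x + - a))   ≈⟨ +-cong p[a]≈0 (*-congˡ (D≈0 _)) ⟩
      0# + (x + - a) * 0#                           ≈⟨ trans (+-identityˡ _) (zeroʳ _) ⟩
      0#                                            ∎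
      where
      D = divide a p
      p[a]≈0 : ⟦ p ⟧ a ≈ 0#
      p[a]≈0 = trans (⟦⟧-cong p (sym (+-identityʳ a))) (p[a+k]≈0 0)
      D[a+1+k]≈0 : ∀ k → ⟦ D ⟧ ((a + 1#) + ιℕ k) ≈ 0#
      D[a+1+k]≈0 k = a*b≈0⇒b≈0 (char0 k) (begin
        ιℕ (suc k) * ⟦ D ⟧ ((a + 1#) + ιℕ k)            ≈⟨ *-congˡ (⟦⟧-cong D (+-assoc a 1# (ιℕ k))) ⟩
        ιℕ (suc k) * ⟦ D ⟧ (a + ιℕ (suc k))             ≈⟨ +-identityˡ _ ⟨
        0# + ιℕ (suc k) * ⟦ D ⟧ (a + ιℕ (suc k))        ≈⟨ +-congʳ p[a]≈0 ⟨
        ⟦ p ⟧ a + ιℕ (suc k) * ⟦ D ⟧ (a + ιℕ (suc k))   ≈⟨ factor-theorem a (ιℕ (suc k)) p ⟨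
        ⟦ p ⟧ (a + ιℕ (suc k))                          ≈⟨ p[a+k]≈0 (suc k) ⟩
        0#                                              ∎)
      D≈0 : ∀ y → ⟦ D ⟧ y ≈ 0#
      D≈0 = go n D (ℕP.≤-trans (length-divide a p) (ℕP.≤-pred p≤1+n)) (a + 1#) D[a+1+k]≈0

  periodic-with-root⇒vanishes : ∀ p a → (∀ x → ⟦ p ⟧ (x + 1#) ≈ ⟦ p ⟧ x) → ⟦ p ⟧ a ≈ 0# →
                                ∀ x → ⟦ p ⟧ x ≈ 0#
  periodic-with-root⇒vanishes p a periodic p[a]≈0 = vanishes-on-progression p a p[a+k]≈0
    where
    p[a+k]≈0 : ∀ k → ⟦ p ⟧ (a + ιℕ k) ≈ 0#
    p[a+k]≈0 zero    = trans (⟦⟧-cong p (+-identityʳ a)) p[a]≈0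
    p[a+k]≈0 (suc k) = begin
      ⟦ p ⟧ (a + (1# + ιℕ k))   ≈⟨ ⟦⟧-cong p (solve 2 (λ a u → a :+ (con 1 :+ u) := (a :+ u) :+ con 1) refl a (ιℕ k)) ⟩
      ⟦ p ⟧ ((a + ιℕ k) + 1#)   ≈⟨ periodic (a + ιℕ k) ⟩
      ⟦ p ⟧ (a + ιℕ k)          ≈⟨ p[a+k]≈0 k ⟩
      0#                        ∎

  twisted-periodic⇒vanishes : ∀ p {a b} → ¬ a ≈ b → (∀ x → a * ⟦ p ⟧ (x + 1#) ≈ b * ⟦ p ⟧ x) →
                              ∀ x → ⟦ p ⟧ x ≈ 0#
  twisted-periodic⇒vanishes p = go (length p) p ℕP.≤-refl
    where
    go : ∀ n p → length p ℕ.≤ n → ∀ {a b} → ¬ a ≈ b → (∀ x → a * ⟦ p ⟧ (x + 1#) ≈ b * ⟦ p ⟧ x) →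
         ∀ x → ⟦ p ⟧ x ≈ 0#
    go n       []         _     a≉b recurrence x = refl
    go (suc n) p@(_ ∷ _)  p≤1+n {a} {b} a≉b recurrence x with ⟦ p ⟧ x ≟ 0#
    ... | yes p[x]≈0 = p[x]≈0
    ... | no  p[x]≉0 = ⊥-elim (a≉b (*-cancelʳ p[x]≉0 (trans (*-congˡ (sym periodic)) (recurrence x))))
      where
      Δ-recurrence : ∀ y → a * ⟦ Δ p ⟧ (y + 1#) ≈ b * ⟦ Δ p ⟧ y
      Δ-recurrence y = ∙-cancelˡ (b * ⟦ p ⟧ y) _ _ (begin
        b * ⟦ p ⟧ y + a * ⟦ Δ p ⟧ (y + 1#)              ≈⟨ +-congʳ (recurrence y) ⟨
        a * ⟦ p ⟧ (y + 1#) + a * ⟦ Δ p ⟧ (y + 1#)       ≈⟨ distribˡ a _ _ ⟨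
        a * (⟦ p ⟧ (y + 1#) + ⟦ Δ p ⟧ (y + 1#))         ≈⟨ *-congˡ (⟦Δ⟧ p (y + 1#)) ⟨
        a * ⟦ p ⟧ ((y + 1#) + 1#)                       ≈⟨ recurrence (y + 1#) ⟩
        b * ⟦ p ⟧ (y + 1#)                              ≈⟨ *-congˡ (⟦Δ⟧ p y) ⟩
        b * (⟦ p ⟧ y + ⟦ Δ p ⟧ y)                       ≈⟨ distribˡ b _ _ ⟩
        b * ⟦ p ⟧ y + b * ⟦ Δ p ⟧ y                     ∎)
      Δp≈0 : ∀ y → ⟦ Δ p ⟧ y ≈ 0#
      Δp≈0 = go n (Δ p) (ℕP.≤-trans (length-Δ p) (ℕP.≤-pred p≤1+n)) a≉b Δ-recurrence
      periodic : ⟦ p ⟧ (x + 1#) ≈ ⟦ p ⟧ x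
      periodic = trans (⟦Δ⟧ p x) (trans (+-congˡ (Δp≈0 x)) (+-identityʳ _))

  vanishes⇒head≈0 : ∀ a q → (∀ x → ⟦ a ∷ q ⟧ x ≈ 0#) → a ≈ 0#
  vanishes⇒head≈0 a q p≈0 = trans (sym (trans (+-congˡ (zeroˡ _)) (+-identityʳ a))) (p≈0 0#)

  vanishes⇒tail-vanishes : ∀ a q → (∀ x → ⟦ a ∷ q ⟧ x ≈ 0#) → ∀ x → ⟦ q ⟧ x ≈ 0#
  vanishes⇒tail-vanishes a q p≈0 = vanishes-on-progression q 1# λ k → a*b≈0⇒b≈0 (char0 k) (begin
    ιℕ (suc k) * ⟦ q ⟧ (ιℕ (suc k))        ≈⟨ +-identityˡ _ ⟨
    0# + ιℕ (suc k) * ⟦ q ⟧ (ιℕ (suc k))   ≈⟨ +-congʳ (vanishes⇒head≈0 a q p≈0) ⟨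
    ⟦ a ∷ q ⟧ (ιℕ (suc k))                 ≈⟨ p≈0 _ ⟩
    0#                                     ∎)

  vanishes⇒coefficients-vanish : ∀ p → (∀ x → ⟦ p ⟧ x ≈ 0#) → ∀ k → coefficient p k ≈ 0#
  vanishes⇒coefficients-vanish []      p≈0 k       = refl
  vanishes⇒coefficients-vanish (a ∷ q) p≈0 zero    = vanishes⇒head≈0 a q p≈0
  vanishes⇒coefficients-vanish (a ∷ q) p≈0 (suc k) =
    vanishes⇒coefficients-vanish q (vanishes⇒tail-vanishes a q p≈0) k

  same-values⇒same-coefficients : ∀ p q → (∀ x → ⟦ p ⟧ x ≈ ⟦ q ⟧ x) →
                                  ∀ k → coefficient p k ≈ coefficient q k
  same-values⇒same-coefficients p q p≈q k = x∙y⁻¹≈ε⇒x≈y _ _ (begin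
    coefficient p k + - coefficient q k          ≈⟨ +-congˡ (coefficient-negate q k) ⟨
    coefficient p k + coefficient (negate q) k   ≈⟨ coefficient-⊕ p (negate q) k ⟨
    coefficient (p ⊕ negate q) k                 ≈⟨ vanishes⇒coefficients-vanish (p ⊕ negate q) p-q≈0 k ⟩
    0#                                           ∎)
    where
    p-q≈0 : ∀ x → ⟦ p ⊕ negate q ⟧ x ≈ 0#
    p-q≈0 x = trans (⟦⊕⟧ p (negate q) x) (trans (+-congˡ (⟦negate⟧ q x)) (x≈y⇒x∙y⁻¹≈ε (p≈q x)))

  -- Sums of polynomial-exponential terms

  record Term : Set c where
    constructor term
    field
      base : Carrier
      poly : Poly
  open Term

  Nonzero : Term → Set ℓ
  Nonzero t = ¬ base t ≈ 0#

  termSum : List Term → ℤ → Carrier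
  termSum []      n = 0#
  termSum (t ∷ T) n = ⟦ poly t ⟧ (ιℤ n) * base t ^ℤ n + termSum T n

  totalLength : List Term → ℕ
  totalLength = ℕL.sum ∘ List.map (length ∘ poly)

  -- The polynomial multiplying γⁿ in termSum T once the terms with base γ are merged.
  component : List Term → Carrier → Poly
  component []      γ = []
  component (t ∷ T) γ with base t ≟ γ
  ... | yes _ = poly t ⊕ component T γ
  ... | no  _ = component T γ

  without : Carrier → List Term → List Term
  without γ []      = []
  without γ (t ∷ T) with base t ≟ γ
  ... | yes _ = without γ T
  ... | no  _ = t ∷ without γ T

  termSum-split : ∀ γ T n → All Nonzero T →
                  termSum T n ≈ ⟦ component T γ ⟧ (ιℤ n) * γ ^ℤ n + termSum (without γ T) n
  termSum-split γ []      n []         = sym (trans (+-identityʳ _) (zeroˡ _))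
  termSum-split γ (t ∷ T) n (b≉0 ∷ nz) with base t ≟ γ
  ... | yes b≈γ = begin
    ⟦ poly t ⟧ (ιℤ n) * base t ^ℤ n + termSum T n      ≈⟨ +-cong (*-congˡ (^ℤ-cong n b≉0 b≈γ)) (termSum-split γ T n nz) ⟩
    u * γ ^ℤ n + (v * γ ^ℤ n + termSum (without γ T) n) ≈⟨ solve 4 (λ u v w e → u :* e :+ (v :* e :+ w) := (u :+ v) :* e :+ w)
                                                             refl u v _ _ ⟩
    (u + v) * γ ^ℤ n + termSum (without γ T) n          ≈⟨ +-congʳ (*-congʳ (⟦⊕⟧ (poly t) (component T γ) (ιℤ n))) ⟨
    ⟦ poly t ⊕ component T γ ⟧ (ιℤ n) * γ ^ℤ n + termSum (without γ T) n ∎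
    where
    u = ⟦ poly t ⟧ (ιℤ n)
    v = ⟦ component T γ ⟧ (ιℤ n)
  ... | no _ = trans (+-congˡ (termSum-split γ T n nz)) (+-left-comm _ _ _)

  component-without-≉ : ∀ {γ γ′} T → ¬ γ′ ≈ γ → component (without γ T) γ′ ≡ component T γ′
  component-without-≉         []      γ′≉γ = ≡.refl
  component-without-≉ {γ} {γ′} (t ∷ T) γ′≉γ with base t ≟ γ
  ... | yes b≈γ with base t ≟ γ′
  ...   | yes b≈γ′ = ⊥-elim (γ′≉γ (trans (sym b≈γ′) b≈γ))
  ...   | no  _    = component-without-≉ T γ′≉γ
  component-without-≉ {γ} {γ′} (t ∷ T) γ′≉γ | no _ with base t ≟ γ′
  ...   | yes _ = ≡.cong (poly t ⊕_) (component-without-≉ T γ′≉γ)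
  ...   | no  _ = component-without-≉ T γ′≉γ

  component-without-≈ : ∀ {γ γ′} T → γ′ ≈ γ → component (without γ T) γ′ ≡ []
  component-without-≈         []      γ′≈γ = ≡.refl
  component-without-≈ {γ} {γ′} (t ∷ T) γ′≈γ with base t ≟ γ
  ... | yes _   = component-without-≈ T γ′≈γ
  ... | no  b≉γ with base t ≟ γ′
  ...   | yes b≈γ′ = ⊥-elim (b≉γ (trans b≈γ′ γ′≈γ))
  ...   | no  _    = component-without-≈ T γ′≈γ

  All-without : ∀ {p} {P : Term → Set p} γ T → All P T → All P (without γ T)
  All-without γ []      []         = []
  All-without γ (t ∷ T) (Pt ∷ PT) with base t ≟ γ
  ... | yes _ = All-without γ T PT
  ... | no  _ = Pt ∷ All-without γ T PT

  length-without : ∀ γ T → length (without γ T) ℕ.≤ length T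
  length-without γ []      = z≤n
  length-without γ (t ∷ T) with base t ≟ γ
  ... | yes _ = ℕP.m≤n⇒m≤1+n (length-without γ T)
  ... | no  _ = s≤s (length-without γ T)

  length-without-base : ∀ t T → length (without (base t) (t ∷ T)) ℕ.≤ length T
  length-without-base t T with base t ≟ base t
  ... | yes _   = length-without (base t) T
  ... | no  b≉b = ⊥-elim (b≉b refl)

  components-of-without-vanish : ∀ δ T → (∀ γ → ¬ γ ≈ δ → ∀ x → ⟦ component T γ ⟧ x ≈ 0#) →
                                 ∀ γ x → ⟦ component (without δ T) γ ⟧ x ≈ 0#
  components-of-without-vanish δ T off γ x with γ ≟ δ
  ... | yes γ≈δ = reflexive (≡.cong (λ p → ⟦ p ⟧ x) (component-without-≈ T γ≈δ))
  ... | no  γ≉δ = trans (reflexive (≡.cong (λ p → ⟦ p ⟧ x) (component-without-≉ T γ≉δ))) (off γ γ≉δ x)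

  termSum-vanishes : ∀ T → All Nonzero T → (∀ γ x → ⟦ component T γ ⟧ x ≈ 0#) → ∀ n → termSum T n ≈ 0#
  termSum-vanishes T = go (length T) T ℕP.≤-refl
    where
    go : ∀ f T → length T ℕ.≤ f → All Nonzero T → (∀ γ x → ⟦ component T γ ⟧ x ≈ 0#) →
         ∀ n → termSum T n ≈ 0#
    go f       []           _            _  _   n = refl
    go (suc f) T@(t ∷ T′)   (s≤s T′≤f)   nz C≈0 n = begin
      termSum T n                                                   ≈⟨ termSum-split γ T n nz ⟩
      ⟦ component T γ ⟧ (ιℤ n) * γ ^ℤ n + termSum (without γ T) n   ≈⟨ +-cong (*-congʳ (C≈0 γ (ιℤ n))) rest≈0 ⟩
      0# * γ ^ℤ n + 0#                                              ≈⟨ trans (+-identityʳ _) (zeroˡ _) ⟩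
      0#                                                            ∎
      where
      γ = base t
      rest≈0 : termSum (without γ T) n ≈ 0#
      rest≈0 = go f (without γ T) (ℕP.≤-trans (length-without-base t T′) T′≤f) (All-without γ T nz)
                  (components-of-without-vanish γ T (λ γ′ _ → C≈0 γ′)) n

  termSum-single-base : ∀ δ T n → All Nonzero T → (∀ γ → ¬ γ ≈ δ → ∀ x → ⟦ component T γ ⟧ x ≈ 0#) →
                        termSum T n ≈ ⟦ component T δ ⟧ (ιℤ n) * δ ^ℤ n
  termSum-single-base δ T n nz off = begin
    termSum T n                                                     ≈⟨ termSum-split δ T n nz ⟩
    ⟦ component T δ ⟧ (ιℤ n) * δ ^ℤ n + termSum (without δ T) n     ≈⟨ +-congˡ rest≈0 ⟩
    ⟦ component T δ ⟧ (ιℤ n) * δ ^ℤ n + 0#                          ≈⟨ +-identityʳ _ ⟩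
    ⟦ component T δ ⟧ (ιℤ n) * δ ^ℤ n                               ∎
    where
    rest≈0 : termSum (without δ T) n ≈ 0#
    rest≈0 = termSum-vanishes (without δ T) (All-without δ T nz) (components-of-without-vanish δ T off) n

  -- Applying E − γ, for E the shift n ↦ n + 1, to P(n) bⁿ gives (b P(n + 1) − γ P(n)) bⁿ.
  -- When b ≈ γ this is b ΔP(n) bⁿ, and writing it with Δ makes the drop in degree visible.
  stepPoly : ∀ {b γ} → Dec (b ≈ γ) → Poly → Poly
  stepPoly {b}     (yes _) p = scale b (Δ p)
  stepPoly {b} {γ} (no  _) p = scale b (shift p) ⊕ scale (- γ) p

  step : Carrier → Term → Term
  step γ (term b p) = term b (stepPoly (b ≟ γ) p)

  ⟦stepPoly⟧ : ∀ {b γ} (d : Dec (b ≈ γ)) p x → b * ⟦ p ⟧ (x + 1#) ≈ γ * ⟦ p ⟧ x + ⟦ stepPoly d p ⟧ x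
  ⟦stepPoly⟧ {b} {γ} (yes b≈γ) p x = begin
    b * ⟦ p ⟧ (x + 1#)              ≈⟨ *-congˡ (⟦Δ⟧ p x) ⟩
    b * (⟦ p ⟧ x + ⟦ Δ p ⟧ x)       ≈⟨ distribˡ b _ _ ⟩
    b * ⟦ p ⟧ x + b * ⟦ Δ p ⟧ x     ≈⟨ +-cong (*-congʳ (sym b≈γ)) (⟦scale⟧ b (Δ p) x) ⟨
    γ * ⟦ p ⟧ x + ⟦ scale b (Δ p) ⟧ x ∎
  ⟦stepPoly⟧ {b} {γ} (no _) p x = begin
    b * ⟦ p ⟧ (x + 1#)                                ≈⟨ +-sub-cancel (γ * ⟦ p ⟧ x) _ ⟨
    γ * ⟦ p ⟧ x + (b * ⟦ p ⟧ (x + 1#) + - (γ * ⟦ p ⟧ x)) ≈⟨ +-congˡ (+-cong b-part γ-part) ⟨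
    γ * ⟦ p ⟧ x + (⟦ scale b (shift p) ⟧ x + ⟦ scale (- γ) p ⟧ x) ≈⟨ +-congˡ (⟦⊕⟧ (scale b (shift p)) (scale (- γ) p) x) ⟨
    γ * ⟦ p ⟧ x + ⟦ scale b (shift p) ⊕ scale (- γ) p ⟧ x ∎
    where
    b-part : ⟦ scale b (shift p) ⟧ x ≈ b * ⟦ p ⟧ (x + 1#)
    b-part = trans (⟦scale⟧ b (shift p) x) (*-congˡ (⟦shift⟧ p x))
    γ-part : ⟦ scale (- γ) p ⟧ x ≈ - (γ * ⟦ p ⟧ x)
    γ-part = trans (⟦scale⟧ (- γ) p x) (sym (-‿distribˡ-* γ _))

  affine-+ : ∀ g v w v′ w′ → (g * v + w) + (g * v′ + w′) ≈ g * (v + v′) + (w + w′)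
  affine-+ = solve 5 (λ g v w v′ w′ → (g :* v :+ w) :+ (g :* v′ :+ w′) := g :* (v :+ v′) :+ (w :+ w′)) refl

  termSum-step : ∀ γ T n → All Nonzero T →
                 termSum T (ℤ.suc n) ≈ γ * termSum T n + termSum (List.map (step γ) T) n
  termSum-step γ []             n []         = sym (trans (+-identityʳ _) (zeroʳ γ))
  termSum-step γ (term b p ∷ T) n (b≉0 ∷ nz) =
    trans (+-cong head-step (termSum-step γ T n nz)) (affine-+ γ _ _ _ _)
    where
    v = ⟦ p ⟧ (ιℤ n)
    w = ⟦ stepPoly (b ≟ γ) p ⟧ (ιℤ n)
    e = b ^ℤ n
    head-step : ⟦ p ⟧ (ιℤ (ℤ.suc n)) * b ^ℤ ℤ.suc n ≈ γ * (v * e) + w * e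
    head-step = begin
      ⟦ p ⟧ (ιℤ (ℤ.suc n)) * b ^ℤ ℤ.suc n   ≈⟨ *-cong (⟦⟧-cong p (ιℤ-suc n)) (^ℤ-suc n b≉0) ⟩
      ⟦ p ⟧ (ιℤ n + 1#) * (b * e)          ≈⟨ solve 3 (λ u b e → u :* (b :* e) := (b :* u) :* e) refl _ b e ⟩
      (b * ⟦ p ⟧ (ιℤ n + 1#)) * e          ≈⟨ *-congʳ (⟦stepPoly⟧ (b ≟ γ) p (ιℤ n)) ⟩
      (γ * v + w) * e                      ≈⟨ solve 4 (λ g v w e → (g :* v :+ w) :* e := g :* (v :* e) :+ w :* e) refl γ v w e ⟩
      γ * (v * e) + w * e                  ∎

  component-step : ∀ γ γ′ T x →
    γ′ * ⟦ component T γ′ ⟧ (x + 1#) ≈ γ * ⟦ component T γ′ ⟧ x + ⟦ component (List.map (step γ) T) γ′ ⟧ x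
  component-step γ γ′ []             x = trans (zeroʳ γ′) (sym (trans (+-identityʳ _) (zeroʳ γ)))
  component-step γ γ′ (term b p ∷ T) x with b ≟ γ′
  ... | no  _    = component-step γ γ′ T x
  ... | yes b≈γ′ = begin
    γ′ * ⟦ p ⊕ C ⟧ (x + 1#)                                 ≈⟨ *-congˡ (⟦⊕⟧ p C (x + 1#)) ⟩
    γ′ * (⟦ p ⟧ (x + 1#) + ⟦ C ⟧ (x + 1#))                  ≈⟨ distribˡ γ′ _ _ ⟩
    γ′ * ⟦ p ⟧ (x + 1#) + γ′ * ⟦ C ⟧ (x + 1#)               ≈⟨ +-cong head-step (component-step γ γ′ T x) ⟩
    (γ * ⟦ p ⟧ x + ⟦ S ⟧ x) + (γ * ⟦ C ⟧ x + ⟦ C′ ⟧ x)      ≈⟨ affine-+ γ _ _ _ _ ⟩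
    γ * (⟦ p ⟧ x + ⟦ C ⟧ x) + (⟦ S ⟧ x + ⟦ C′ ⟧ x)          ≈⟨ +-cong (*-congˡ (⟦⊕⟧ p C x)) (⟦⊕⟧ S C′ x) ⟨
    γ * ⟦ p ⊕ C ⟧ x + ⟦ S ⊕ C′ ⟧ x                          ∎
    where
    C  = component T γ′
    C′ = component (List.map (step γ) T) γ′
    S  = stepPoly (b ≟ γ) p
    head-step : γ′ * ⟦ p ⟧ (x + 1#) ≈ γ * ⟦ p ⟧ x + ⟦ S ⟧ x
    head-step = trans (*-congʳ (sym b≈γ′)) (⟦stepPoly⟧ (b ≟ γ) p x)

  stepped-component-vanishes⇒recurrence : ∀ {γ γ′} T → (∀ x → ⟦ component (List.map (step γ) T) γ′ ⟧ x ≈ 0#) →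
    ∀ x → γ′ * ⟦ component T γ′ ⟧ (x + 1#) ≈ γ * ⟦ component T γ′ ⟧ x
  stepped-component-vanishes⇒recurrence {γ} {γ′} T stepped≈0 x =
    trans (component-step γ γ′ T x) (trans (+-congˡ (stepped≈0 x)) (+-identityʳ _))

  off-base-component-vanishes : ∀ {γ γ′} T → ¬ γ′ ≈ γ →
    (∀ x → ⟦ component (List.map (step γ) T) γ′ ⟧ x ≈ 0#) → ∀ x → ⟦ component T γ′ ⟧ x ≈ 0#
  off-base-component-vanishes {γ} {γ′} T γ′≉γ stepped≈0 =
    twisted-periodic⇒vanishes (component T γ′) γ′≉γ (stepped-component-vanishes⇒recurrence T stepped≈0)

  on-base-component-vanishes : ∀ {γ γ′} M T → γ′ ≈ γ → ¬ γ ≈ 0# → All Nonzero T → termSum T M ≈ 0# →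
    (∀ γ″ x → ⟦ component (List.map (step γ) T) γ″ ⟧ x ≈ 0#) → ∀ x → ⟦ component T γ′ ⟧ x ≈ 0#
  on-base-component-vanishes {γ} {γ′} M T γ′≈γ γ≉0 nz T[M]≈0 stepped≈0 =
    periodic-with-root⇒vanishes C (ιℤ M) periodic C[M]≈0
    where
    C = component T γ′
    γ′≉0 : ¬ γ′ ≈ 0#
    γ′≉0 γ′≈0 = γ≉0 (trans (sym γ′≈γ) γ′≈0)
    periodic : ∀ x → ⟦ C ⟧ (x + 1#) ≈ ⟦ C ⟧ x
    periodic x = *-cancelˡ γ′≉0 (trans (stepped-component-vanishes⇒recurrence T (stepped≈0 γ′) x) (*-congʳ (sym γ′≈γ)))
    off : ∀ γ″ → ¬ γ″ ≈ γ′ → ∀ x → ⟦ component T γ″ ⟧ x ≈ 0#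
    off γ″ γ″≉γ′ = off-base-component-vanishes T (λ γ″≈γ → γ″≉γ′ (trans γ″≈γ (sym γ′≈γ))) (stepped≈0 γ″)
    C[M]≈0 : ⟦ C ⟧ (ιℤ M) ≈ 0#
    C[M]≈0 = a*b≈0⇒b≈0 (^ℤ-nonzero M γ′≉0)
               (trans (*-comm _ _) (trans (sym (termSum-single-base γ′ T M nz off)) T[M]≈0))

  stepped-components-vanish⇒components-vanish : ∀ {γ} M T → ¬ γ ≈ 0# → All Nonzero T → termSum T M ≈ 0# →
    (∀ γ′ x → ⟦ component (List.map (step γ) T) γ′ ⟧ x ≈ 0#) → ∀ γ′ x → ⟦ component T γ′ ⟧ x ≈ 0#
  stepped-components-vanish⇒components-vanish {γ} M T γ≉0 nz T[M]≈0 stepped≈0 γ′ with γ′ ≟ γ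
  ... | yes γ′≈γ = on-base-component-vanishes M T γ′≈γ γ≉0 nz T[M]≈0 stepped≈0
  ... | no  γ′≉γ = off-base-component-vanishes T γ′≉γ (stepped≈0 γ′)

  length-stepPoly : ∀ {b γ} (d : Dec (b ≈ γ)) p → length (stepPoly d p) ℕ.≤ length p
  length-stepPoly {b}     (yes _) p =
    ℕP.≤-trans (ℕP.≤-reflexive (length-scale b (Δ p))) (ℕP.≤-trans (length-Δ p) ℕP.pred[n]≤n)
  length-stepPoly {b} {γ} (no  _) p =
    length-⊕ (scale b (shift p)) (scale (- γ) p)
             (ℕP.≤-trans (ℕP.≤-reflexive (length-scale b (shift p))) (length-shift p))
             (ℕP.≤-reflexive (length-scale (- γ) p))

  length-stepPoly-base : ∀ b a q → length (stepPoly (b ≟ b) (a ∷ q)) ℕ.≤ length q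
  length-stepPoly-base b a q with b ≟ b
  ... | yes _   = ℕP.≤-trans (ℕP.≤-reflexive (length-scale b (Δ (a ∷ q)))) (length-Δ (a ∷ q))
  ... | no  b≉b = ⊥-elim (b≉b refl)

  totalLength-step : ∀ γ T → totalLength (List.map (step γ) T) ℕ.≤ totalLength T
  totalLength-step γ []             = z≤n
  totalLength-step γ (term b p ∷ T) = ℕP.+-mono-≤ (length-stepPoly (b ≟ γ) p) (totalLength-step γ T)

  component-empty-head : ∀ b T γ → component (term b [] ∷ T) γ ≡ component T γ
  component-empty-head b T γ with b ≟ γ
  ... | yes _ = ≡.refl
  ... | no  _ = ≡.refl

  stepped-window-vanishes : ∀ γ T M L → All Nonzero T → (∀ k → k ℕ.< suc L → termSum T (M ℤ.+ + k) ≈ 0#) →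
                            ∀ k → k ℕ.< L → termSum (List.map (step γ) T) (M ℤ.+ + k) ≈ 0#
  stepped-window-vanishes γ T M L nz window k k<L = begin
    termSum T′ (M ℤ.+ + k)                                   ≈⟨ +-identityˡ _ ⟨
    0# + termSum T′ (M ℤ.+ + k)                              ≈⟨ +-congʳ γ*T≈0 ⟨
    γ * termSum T (M ℤ.+ + k) + termSum T′ (M ℤ.+ + k)       ≈⟨ termSum-step γ T (M ℤ.+ + k) nz ⟨
    termSum T (ℤ.suc (M ℤ.+ + k))                            ≈⟨ reflexive (≡.cong (termSum T) (1+[M+j]≡M+[1+j] M (+ k))) ⟩
    termSum T (M ℤ.+ + suc k)                                ≈⟨ window (suc k) (s≤s k<L) ⟩
    0#                                                       ∎
    where
    T′ = List.map (step γ) T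
    γ*T≈0 : γ * termSum T (M ℤ.+ + k) ≈ 0#
    γ*T≈0 = trans (*-congˡ (window k (ℕP.m≤n⇒m≤1+n k<L))) (zeroʳ γ)

  window-vanishing⇒components-vanish : ∀ T L M → All Nonzero T → totalLength T ℕ.≤ L →
    (∀ k → k ℕ.< L → termSum T (M ℤ.+ + k) ≈ 0#) → ∀ γ x → ⟦ component T γ ⟧ x ≈ 0#
  window-vanishing⇒components-vanish T = go (length T ℕ.+ totalLength T) T ℕP.≤-refl
    where
    go : ∀ f T → length T ℕ.+ totalLength T ℕ.≤ f → ∀ L M → All Nonzero T → totalLength T ℕ.≤ L →
         (∀ k → k ℕ.< L → termSum T (M ℤ.+ + k) ≈ 0#) → ∀ γ x → ⟦ component T γ ⟧ x ≈ 0#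
    go f       []                  _  L M _ _ _ γ x = refl
    go zero    (_ ∷ _)             ()
    go (suc f) (term b [] ∷ T)     (s≤s μ) L M (_ ∷ nz) tl window γ x =
      trans (reflexive (≡.cong (λ p → ⟦ p ⟧ x) (component-empty-head b T γ))) (go f T μ L M nz tl window′ γ x)
      where
      window′ : ∀ k → k ℕ.< L → termSum T (M ℤ.+ + k) ≈ 0#
      window′ k k<L = trans (sym (trans (+-congʳ (zeroˡ _)) (+-identityˡ _))) (window k k<L)
    go (suc f) (term b (_ ∷ _) ∷ T) _ zero M _ ()
    go (suc f) T₀@(term b (a ∷ q) ∷ T) (s≤s μ) (suc L) M nz@(b≉0 ∷ _) (s≤s tl) window =
      stepped-components-vanish⇒components-vanish M T₀ b≉0 nz T₀[M]≈0
        (go f T′ μ′ L M (map⁺ nz) (ℕP.≤-trans stepped-length tl) (stepped-window-vanishes b T₀ M L nz window))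
      where
      T′ = List.map (step b) T₀
      stepped-length : totalLength T′ ℕ.≤ length q ℕ.+ totalLength T
      stepped-length = ℕP.+-mono-≤ (length-stepPoly-base b a q) (totalLength-step b T)
      μ′ : length T′ ℕ.+ totalLength T′ ℕ.≤ f
      μ′ = ℕP.≤-trans (ℕP.+-mono-≤ (ℕP.≤-reflexive (ListP.length-map (step b) T₀)) stepped-length)
                      (ℕP.≤-trans (ℕP.≤-reflexive (≡.sym (ℕP.+-suc (length T) _))) μ)
      T₀[M]≈0 : termSum T₀ M ≈ 0#
      T₀[M]≈0 = trans (reflexive (≡.cong (termSum T₀) (≡.sym (ℤP.+-identityʳ M)))) (window 0 (s≤s z≤n))

  -- Representations

  toPoly : NZPoly → Poly
  toPoly Q = tabulate (coef Q)

  ΣF-cong : ∀ n {f g : Fin n → Carrier} → (∀ i → f i ≈ g i) → ΣF n f ≈ ΣF n g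
  ΣF-cong zero    f≈g = refl
  ΣF-cong (suc n) f≈g = +-cong (f≈g Fin.zero) (ΣF-cong n (f≈g ∘ Fin.suc))

  *-distribˡ-ΣF : ∀ n a (f : Fin n → Carrier) → a * ΣF n f ≈ ΣF n (λ i → a * f i)
  *-distribˡ-ΣF zero    a f = zeroʳ a
  *-distribˡ-ΣF (suc n) a f = trans (distribˡ a _ _) (+-congˡ (*-distribˡ-ΣF n a (f ∘ Fin.suc)))

  ⟦tabulate⟧ : ∀ n (f : Fin n → Carrier) x → ⟦ tabulate f ⟧ x ≈ ΣF n (λ j → f j * x ^ℕ Fin.toℕ j)
  ⟦tabulate⟧ zero    f x = refl
  ⟦tabulate⟧ (suc n) f x = +-cong (sym (*-identityʳ (f Fin.zero))) (begin
    x * ⟦ tabulate (f ∘ Fin.suc) ⟧ x                      ≈⟨ *-congˡ (⟦tabulate⟧ n (f ∘ Fin.suc) x) ⟩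
    x * ΣF n (λ j → f (Fin.suc j) * x ^ℕ Fin.toℕ j)       ≈⟨ *-distribˡ-ΣF n x _ ⟩
    ΣF n (λ j → x * (f (Fin.suc j) * x ^ℕ Fin.toℕ j))     ≈⟨ ΣF-cong n (λ j → *-left-comm x _ _) ⟩
    ΣF n (λ j → f (Fin.suc j) * (x * x ^ℕ Fin.toℕ j))     ∎)

  ⟦toPoly⟧ : ∀ Q x → ⟦ toPoly Q ⟧ x ≈ eval Q x
  ⟦toPoly⟧ Q = ⟦tabulate⟧ (suc (deg Q)) (coef Q)

  coefficient-tabulate-< : ∀ n (f : Fin n → Carrier) k (k<n : k ℕ.< n) →
                           coefficient (tabulate f) k ≡ f (fromℕ< k<n)
  coefficient-tabulate-< (suc n) f zero    _         = ≡.refl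
  coefficient-tabulate-< (suc n) f (suc k) (s≤s k<n) = coefficient-tabulate-< n (f ∘ Fin.suc) k k<n

  coefficient-tabulate-≥ : ∀ n (f : Fin n → Carrier) k → n ℕ.≤ k → coefficient (tabulate f) k ≡ 0#
  coefficient-tabulate-≥ zero    f k       _         = ≡.refl
  coefficient-tabulate-≥ (suc n) f (suc k) (s≤s n≤k) = coefficient-tabulate-≥ n (f ∘ Fin.suc) k n≤k

  coefficient-toPoly : ∀ Q k → coefficient (toPoly Q) k ≡ coeff Q k
  coefficient-toPoly Q k with k ℕ.<? suc (deg Q)
  ... | yes k<  = coefficient-tabulate-< (suc (deg Q)) (coef Q) k k<
  ... | no  k≮  = coefficient-tabulate-≥ (suc (deg Q)) (coef Q) k (ℕP.≮⇒≥ k≮)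

  leading-coeff≉0 : ∀ Q → ¬ coeff Q (deg Q) ≈ 0#
  leading-coeff≉0 Q lead≈0 = lead≉0 Q (trans (reflexive (≡.sym coeff≡lead)) lead≈0)
    where
    coeff≡lead : coeff Q (deg Q) ≡ coef Q (fromℕ (deg Q))
    coeff≡lead = ≡.trans (≡.sym (coefficient-toPoly Q (deg Q)))
                   (≡.trans (coefficient-tabulate-< (suc (deg Q)) (coef Q) (deg Q) (ℕP.n<1+n (deg Q)))
                            (≡.cong (coef Q) (≡.sym (FinP.fromℕ-def (deg Q)))))

  coeff-above-deg : ∀ Q k → deg Q ℕ.< k → coeff Q k ≈ 0#
  coeff-above-deg Q k deg<k =
    reflexive (≡.trans (≡.sym (coefficient-toPoly Q k)) (coefficient-tabulate-≥ (suc (deg Q)) (coef Q) k deg<k))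

  deg-unique : ∀ Q Q̃ → (∀ k → coeff Q k ≈ coeff Q̃ k) → deg Q ≡ deg Q̃
  deg-unique Q Q̃ same with ℕP.<-cmp (deg Q) (deg Q̃)
  ... | tri< d<d̃ _ _ = ⊥-elim (leading-coeff≉0 Q̃ (trans (sym (same (deg Q̃))) (coeff-above-deg Q _ d<d̃)))
  ... | tri≈ _ d≡d̃ _ = d≡d̃
  ... | tri> _ _ d>d̃ = ⊥-elim (leading-coeff≉0 Q (trans (same (deg Q)) (coeff-above-deg Q̃ _ d>d̃)))

  toPoly-nonvanishing : ∀ Q → ¬ (∀ x → ⟦ toPoly Q ⟧ x ≈ 0#)
  toPoly-nonvanishing Q Q≈0 = leading-coeff≉0 Q
    (trans (reflexive (≡.sym (coefficient-toPoly Q (deg Q)))) (vanishes⇒coefficients-vanish (toPoly Q) Q≈0 (deg Q)))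

  same-values⇒same-coeffs : ∀ Q Q̃ → (∀ x → ⟦ toPoly Q ⟧ x ≈ ⟦ toPoly Q̃ ⟧ x) → ∀ k → coeff Q k ≈ coeff Q̃ k
  same-values⇒same-coeffs Q Q̃ same k = ≡.subst₂ _≈_ (coefficient-toPoly Q k) (coefficient-toPoly Q̃ k)
    (same-values⇒same-coefficients (toPoly Q) (toPoly Q̃) same k)

  termsOf : ∀ {n} → (Fin n → Carrier) → (Fin n → Poly) → List Term
  termsOf β p = tabulate (λ i → term (β i) (p i))

  terms : PERep → List Term
  terms R = termsOf (α R) (toPoly ∘ P R)

  component-termsOf-absent : ∀ {n γ} (β : Fin n → Carrier) p → (∀ j → ¬ β j ≈ γ) →
                             component (termsOf β p) γ ≡ []
  component-termsOf-absent {zero}        β p absent = ≡.refl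
  component-termsOf-absent {suc n} {γ}   β p absent with β Fin.zero ≟ γ
  ... | yes β₀≈γ = ⊥-elim (absent Fin.zero β₀≈γ)
  ... | no  _    = component-termsOf-absent (β ∘ Fin.suc) (p ∘ Fin.suc) (absent ∘ Fin.suc)

  component-termsOf-unique : ∀ {n γ} (β : Fin n → Carrier) p i → (∀ j → j ≢ i → ¬ β j ≈ β i) → γ ≈ β i →
                             ∀ x → ⟦ component (termsOf β p) γ ⟧ x ≈ ⟦ p i ⟧ x
  component-termsOf-unique {suc n} {γ} β p Fin.zero distinct γ≈β₀ x with β Fin.zero ≟ γ
  ... | no  β₀≉γ = ⊥-elim (β₀≉γ (sym γ≈β₀))
  ... | yes _    = begin
    ⟦ p Fin.zero ⊕ C ⟧ x           ≈⟨ ⟦⊕⟧ (p Fin.zero) C x ⟩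
    ⟦ p Fin.zero ⟧ x + ⟦ C ⟧ x     ≈⟨ +-congˡ (reflexive (≡.cong (λ q → ⟦ q ⟧ x) C≡[])) ⟩
    ⟦ p Fin.zero ⟧ x + 0#          ≈⟨ +-identityʳ _ ⟩
    ⟦ p Fin.zero ⟧ x               ∎
    where
    C = component (termsOf (β ∘ Fin.suc) (p ∘ Fin.suc)) γ
    C≡[] : C ≡ []
    C≡[] = component-termsOf-absent (β ∘ Fin.suc) (p ∘ Fin.suc)
             (λ j βj≈γ → distinct (Fin.suc j) (λ ()) (trans βj≈γ γ≈β₀))
  component-termsOf-unique {suc n} {γ} β p (Fin.suc i) distinct γ≈βi x with β Fin.zero ≟ γ
  ... | yes β₀≈γ = ⊥-elim (distinct Fin.zero (λ ()) (trans β₀≈γ γ≈βi))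
  ... | no  _    = component-termsOf-unique (β ∘ Fin.suc) (p ∘ Fin.suc) i
                     (λ j j≢i → distinct (Fin.suc j) (j≢i ∘ FinP.suc-injective)) γ≈βi x

  termSum-termsOf : ∀ {n} (β : Fin n → Carrier) p m → termSum (termsOf β p) m ≈ ΣF n (λ i → ⟦ p i ⟧ (ιℤ m) * β i ^ℤ m)
  termSum-termsOf {zero}  β p m = refl
  termSum-termsOf {suc n} β p m = +-congˡ (termSum-termsOf (β ∘ Fin.suc) (p ∘ Fin.suc) m)

  termSum-terms : ∀ R m → termSum (terms R) m ≈ value R m
  termSum-terms R m = trans (termSum-termsOf (α R) (toPoly ∘ P R) m)
                            (ΣF-cong (s R) (λ i → *-congʳ (⟦toPoly⟧ (P R i) (ιℤ m))))

  module ℕΣ = MonoidSum ℕP.+-0-commutativeMonoid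

  totalLength-termsOf : ∀ {n} (β : Fin n → Carrier) (Q : Fin n → NZPoly) →
                        totalLength (termsOf β (toPoly ∘ Q)) ≡ n ℕ.+ ℕΣ.sum (deg ∘ Q)
  totalLength-termsOf {zero}  β Q = ≡.refl
  totalLength-termsOf {suc n} β Q = ≡.trans
    (≡.cong₂ ℕ._+_ (ListP.length-tabulate (coef (Q Fin.zero))) (totalLength-termsOf (β ∘ Fin.suc) (Q ∘ Fin.suc)))
    (≡.cong suc (ℕ+-left-comm (deg (Q Fin.zero)) n _))
    where open CommutativeSemigroupProperties ℕP.+-commutativeSemigroup using () renaming (x∙yz≈y∙xz to ℕ+-left-comm)

  -- rank adds up the degrees with a function local to its definition; that sum is reached by
  -- unfolding rank of the representation with its first term removed.
  rank≡ : ∀ R → rank R ≡ s R ℕ.+ ℕΣ.sum (deg ∘ P R)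
  rank≡ R = go (s R) (α R) (P R) (α≉0 R) (distinct R)
    where
    go : ∀ n β Q β≉0 β-distinct →
         rank (record { s = n ; α = β ; P = Q ; α≉0 = β≉0 ; distinct = β-distinct }) ≡ n ℕ.+ ℕΣ.sum (deg ∘ Q)
    go zero    β Q β≉0 β-distinct = ≡.refl
    go (suc n) β Q β≉0 β-distinct =
      ≡.cong (λ z → suc (n ℕ.+ (deg (Q Fin.zero) ℕ.+ z))) (ℕP.+-cancelˡ-≡ n _ _ tail-rank)
      where
      tail-rank = go n (β ∘ Fin.suc) (Q ∘ Fin.suc) (β≉0 ∘ Fin.suc)
                    (λ i j i≢j → β-distinct (Fin.suc i) (Fin.suc j) (i≢j ∘ FinP.suc-injective))

  totalLength-terms : ∀ R → totalLength (terms R) ≡ rank R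
  totalLength-terms R = ≡.trans (totalLength-termsOf (α R) (P R)) (≡.sym (rank≡ R))

  negateTerm : Term → Term
  negateTerm (term b p) = term b (negate p)

  termSum-negate : ∀ T n → termSum (List.map negateTerm T) n ≈ - termSum T n
  termSum-negate []             n = sym ε⁻¹≈ε
  termSum-negate (term b p ∷ T) n = trans (+-cong negated-head (termSum-negate T n)) (⁻¹-∙-comm _ _)
    where
    negated-head : ⟦ negate p ⟧ (ιℤ n) * b ^ℤ n ≈ - (⟦ p ⟧ (ιℤ n) * b ^ℤ n)
    negated-head = trans (*-congʳ (⟦negate⟧ p (ιℤ n))) (sym (-‿distribˡ-* _ _))

  component-negate : ∀ T γ x → ⟦ component (List.map negateTerm T) γ ⟧ x ≈ - ⟦ component T γ ⟧ x
  component-negate []             γ x = sym ε⁻¹≈ε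
  component-negate (term b p ∷ T) γ x with b ≟ γ
  ... | no  _ = component-negate T γ x
  ... | yes _ = begin
    ⟦ negate p ⊕ C̄ ⟧ x           ≈⟨ ⟦⊕⟧ (negate p) C̄ x ⟩
    ⟦ negate p ⟧ x + ⟦ C̄ ⟧ x     ≈⟨ +-cong (⟦negate⟧ p x) (component-negate T γ x) ⟩
    - ⟦ p ⟧ x + - ⟦ C ⟧ x        ≈⟨ ⁻¹-∙-comm _ _ ⟩
    - (⟦ p ⟧ x + ⟦ C ⟧ x)        ≈⟨ -‿cong (⟦⊕⟧ p C x) ⟨
    - ⟦ p ⊕ C ⟧ x                ∎
    where
    C  = component T γ
    C̄ = component (List.map negateTerm T) γ

  totalLength-negate : ∀ T → totalLength (List.map negateTerm T) ≡ totalLength T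
  totalLength-negate []             = ≡.refl
  totalLength-negate (term b p ∷ T) = ≡.cong₂ ℕ._+_ (ListP.length-map -_ p) (totalLength-negate T)

  termSum-++ : ∀ A B n → termSum (A ++ B) n ≈ termSum A n + termSum B n
  termSum-++ []      B n = sym (+-identityˡ _)
  termSum-++ (t ∷ A) B n = trans (+-congˡ (termSum-++ A B n)) (sym (+-assoc _ _ _))

  component-++ : ∀ A B γ x → ⟦ component (A ++ B) γ ⟧ x ≈ ⟦ component A γ ⟧ x + ⟦ component B γ ⟧ x
  component-++ []      B γ x = sym (+-identityˡ _)
  component-++ (t ∷ A) B γ x with base t ≟ γ
  ... | no  _ = component-++ A B γ x
  ... | yes _ = begin
    ⟦ poly t ⊕ component (A ++ B) γ ⟧ x                              ≈⟨ ⟦⊕⟧ (poly t) _ x ⟩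
    ⟦ poly t ⟧ x + ⟦ component (A ++ B) γ ⟧ x                        ≈⟨ +-congˡ (component-++ A B γ x) ⟩
    ⟦ poly t ⟧ x + (⟦ component A γ ⟧ x + ⟦ component B γ ⟧ x)       ≈⟨ +-assoc _ _ _ ⟨
    (⟦ poly t ⟧ x + ⟦ component A γ ⟧ x) + ⟦ component B γ ⟧ x       ≈⟨ +-congʳ (⟦⊕⟧ (poly t) _ x) ⟨
    ⟦ poly t ⊕ component A γ ⟧ x + ⟦ component B γ ⟧ x               ∎

  totalLength-++ : ∀ A B → totalLength (A ++ B) ≡ totalLength A ℕ.+ totalLength B
  totalLength-++ A B = ≡.trans (≡.cong ℕL.sum (ListP.map-++ (length ∘ poly) A B))
                               (sum-++ (List.map (length ∘ poly) A) (List.map (length ∘ poly) B))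

  AgreeOn : ℤ → ℕ → PERep → PERep → Set ℓ
  AgreeOn M L R R̃ = ∀ k → k ℕ.< L → value R (M ℤ.+ + k) ≈ value R̃ (M ℤ.+ + k)

  agreement⇒same-components : ∀ M L R R̃ → AgreeOn M L R R̃ → rank R ℕ.+ rank R̃ ℕ.≤ L →
    ∀ γ x → ⟦ component (terms R) γ ⟧ x ≈ ⟦ component (terms R̃) γ ⟧ x
  agreement⇒same-components M L R R̃ agree ranks≤L γ x = x∙y⁻¹≈ε⇒x≈y _ _ (begin
    ⟦ component (terms R) γ ⟧ x + - ⟦ component (terms R̃) γ ⟧ x       ≈⟨ +-congˡ (component-negate (terms R̃) γ x) ⟨
    ⟦ component (terms R) γ ⟧ x + ⟦ component (negated R̃) γ ⟧ x       ≈⟨ component-++ (terms R) (negated R̃) γ x ⟨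
    ⟦ component D γ ⟧ x                                              ≈⟨ window-vanishing⇒components-vanish D L M nz length≤L window γ x ⟩
    0#                                                               ∎)
    where
    negated = List.map negateTerm ∘ terms
    D = terms R ++ negated R̃
    nz : All Nonzero D
    nz = ++⁺ (tabulate⁺ (α≉0 R)) (map⁺ (tabulate⁺ (α≉0 R̃)))
    length≤L : totalLength D ℕ.≤ L
    length≤L = ℕP.≤-trans (ℕP.≤-reflexive (≡.trans (totalLength-++ (terms R) (negated R̃))
                 (≡.cong₂ ℕ._+_ (totalLength-terms R) (≡.trans (totalLength-negate (terms R̃)) (totalLength-terms R̃)))))
                 ranks≤L
    window : ∀ k → k ℕ.< L → termSum D (M ℤ.+ + k) ≈ 0#
    window k k<L = begin
      termSum D (M ℤ.+ + k)                                           ≈⟨ termSum-++ (terms R) (negated R̃) _ ⟩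
      termSum (terms R) (M ℤ.+ + k) + termSum (negated R̃) (M ℤ.+ + k) ≈⟨ +-congˡ (termSum-negate (terms R̃) _) ⟩
      termSum (terms R) (M ℤ.+ + k) + - termSum (terms R̃) (M ℤ.+ + k) ≈⟨ +-cong (termSum-terms R _) (-‿cong (termSum-terms R̃ _)) ⟩
      value R (M ℤ.+ + k) + - value R̃ (M ℤ.+ + k)                     ≈⟨ x≈y⇒x∙y⁻¹≈ε (agree k k<L) ⟩
      0#                                                              ∎

  matching-term : ∀ M L R R̃ → AgreeOn M L R R̃ → rank R ℕ.+ rank R̃ ℕ.≤ L → ∀ i →
    Σ (Fin (s R̃)) λ j → α R i ≈ α R̃ j × (∀ k → coeff (P R i) k ≈ coeff (P R̃ j) k)
  matching-term M L R R̃ agree ranks≤L i = match (FinP.any? (λ j → α R̃ j ≟ α R i))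
    where
    γ = α R i
    Pᵢ≈C̃ : ∀ x → ⟦ toPoly (P R i) ⟧ x ≈ ⟦ component (terms R̃) γ ⟧ x
    Pᵢ≈C̃ x = trans (sym (component-termsOf-unique (α R) (toPoly ∘ P R) i (λ j j≢i → distinct R j i j≢i) refl x))
                    (agreement⇒same-components M L R R̃ agree ranks≤L γ x)
    match : Dec (Σ (Fin (s R̃)) λ j → α R̃ j ≈ γ) →
            Σ (Fin (s R̃)) λ j → γ ≈ α R̃ j × (∀ k → coeff (P R i) k ≈ coeff (P R̃ j) k)
    match (yes (j , α̃ⱼ≈γ)) = j , sym α̃ⱼ≈γ , same-values⇒same-coeffs (P R i) (P R̃ j) λ x → trans (Pᵢ≈C̃ x)
      (component-termsOf-unique (α R̃) (toPoly ∘ P R̃) j (λ j′ j′≢j → distinct R̃ j′ j j′≢j) (sym α̃ⱼ≈γ) x)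
    match (no none) = ⊥-elim (toPoly-nonvanishing (P R i) λ x → trans (Pᵢ≈C̃ x)
      (reflexive (≡.cong (λ p → ⟦ p ⟧ x) (component-termsOf-absent (α R̃) (toPoly ∘ P R̃) (λ j α̃ⱼ≈γ → none (j , α̃ⱼ≈γ))))))

  α-injective : ∀ R {i j} → α R i ≈ α R j → i ≡ j
  α-injective R {i} {j} αᵢ≈αⱼ with i Fin.≟ j
  ... | yes i≡j = i≡j
  ... | no  i≢j = ⊥-elim (distinct R i j i≢j αᵢ≈αⱼ)

  agreement⇒rearrangement : ∀ M L R R̃ → AgreeOn M L R R̃ → rank R ℕ.+ rank R̃ ℕ.≤ L →
                            SameUpToRearrangement R R̃
  agreement⇒rearrangement M L R R̃ agree ranks≤L =
    ↔⇒≡ π , ↔⇒⤖ π , λ i → proj₁ (proj₂ (forth i)) , deg-unique _ _ (proj₂ (proj₂ (forth i))) , proj₂ (proj₂ (forth i))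
    where
    forth = matching-term M L R R̃ agree ranks≤L
    back  = matching-term M L R̃ R (λ k k<L → sym (agree k k<L)) (ℕP.≤-trans (ℕP.≤-reflexive (ℕP.+-comm (rank R̃) (rank R))) ranks≤L)
    to   = proj₁ ∘ forth
    from = proj₁ ∘ back
    from∘to : ∀ i → from (to i) ≡ i
    from∘to i = α-injective R (trans (sym (proj₁ (proj₂ (back (to i))))) (sym (proj₁ (proj₂ (forth i)))))
    to∘from : ∀ j → to (from j) ≡ j
    to∘from j = α-injective R̃ (trans (sym (proj₁ (proj₂ (forth (from j))))) (sym (proj₁ (proj₂ (back j)))))
    π : Fin (s R) ↔ Fin (s R̃)
    π = mk↔ₛ′ to from to∘from from∘to

  rank-cong : ∀ R R̃ → SameUpToRearrangement R R̃ → rank R ≡ rank R̃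
  rank-cong R R̃ (s≡s̃ , σ , same) = ≡.trans (rank≡ R) (≡.trans
    (≡.cong₂ ℕ._+_ s≡s̃ (≡.trans (ℕΣ.sum-cong-≗ (λ i → proj₁ (proj₂ (same i))))
                                (≡.sym (ℕΣ.sum-permute (deg ∘ P R̃) (⤖⇒↔ σ)))))
    (≡.sym (rank≡ R̃)))

  proper-representations-rearrange : ∀ {M N u} R R̃ → M ℤ.≤ N →
    Represents M N u R → ProperRank M N (rank R) → Represents M N u R̃ → ProperRank M N (rank R̃) →
    SameUpToRearrangement R R̃
  proper-representations-rearrange {M} {N} R R̃ M≤N repR properR repR̃ properR̃ =
    agreement⇒rearrangement M (width M N) R R̃ agree
      (halves⇒sum≤ {rank R} {rank R̃} (double≤width (rank R) M≤N properR) (double≤width (rank R̃) M≤N properR̃))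
    where
    agree : AgreeOn M (width M N) R R̃
    agree k k<w = let (lo , hi) = in-window M≤N k k<w in trans (sym (repR _ lo hi)) (repR̃ _ lo hi)

corollary2p10 : ∀ {c ℓ : Level} (K : AlgebraicNumbers c ℓ) →
    let open PolyExp K in
    (M N : ℤ) → M ℤ.≤ N → (u : ℤ → Carrier) →
    (∀ (r r̃ : ℕ) → IsProperPE M N u r → IsProperPE M N u r̃ → r ≡ r̃) ×
    (∀ (R R̃ : PERep) → Represents M N u R → ProperRank M N (rank R) →
    Represents M N u R̃ → ProperRank M N (rank R̃) →
    SameUpToRearrangement R R̃)
corollary2p10 K M N M≤N u = ranks-agree , λ R R̃ → proper-representations-rearrange R R̃ M≤N
  where
  open PolyExp K
  open PolynomialExponential K
  ranks-agree : ∀ (r r̃ : ℕ) → IsProperPE M N u r → IsProperPE M N u r̃ → r ≡ r̃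
  ranks-agree _ _ ((R , repR , ≡.refl) , properR) ((R̃ , repR̃ , ≡.refl) , properR̃) =
    rank-cong R R̃ (proper-representations-rearrange R R̃ M≤N repR properR repR̃ properR̃)
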